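{- Let $G$ be a finite simple graph and $u \in V(G)$. Then $\gamma_{gr}^L(G) - 2 \leq \gamma_{gr}^L(G - u) \leq \gamma_{gr}^L(G)$, where $G - u$ is the graph obtained from $G$ by deleting $u$ and all edges incident to it.
   Context: For a vertex $v$, $N(v)$ is its open neighborhood (the set of its neighbors) and $N[v] = N(v) \cup \{v\}$ its closed neighborhood. An L-sequence of a graph $G$ is a sequence $(v_1, \ldots, v_k)$ of distinct vertices of $G$ such that for every $i \in \{1,\ldots,k\}$, $N[v_i] \setminus \bigcup_{j=1}^{i-1} N(v_j) \neq \emptyset$. The L-Grundy domination number $\gamma_{gr}^L(G)$ is the maximum length of an L-sequence of $G$. -}

module Defs where

open import Data.Nat using (ℕ; suc; _≤_)
open import Data.Fin using (Fin; punchIn)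
open import Data.List using (List; []; _∷_; length)
open import Data.List.Relation.Unary.All using (All)
open import Data.List.Relation.Unary.Unique.Propositional using (Unique)
open import Data.Product using (Σ; ∃; _×_)
open import Data.Sum using (_⊎_)
open import Data.Unit using (⊤)
open import Relation.Nullary using (¬_)
open import Relation.Binary.PropositionalEquality using (_≡_)

record Graph (n : ℕ) : Set₁ where
  field
    Adj     : Fin n → Fin n → Set
    sym     : ∀ {x y} → Adj x y → Adj y x
    irrefl  : ∀ {x} → ¬ Adj x x

open Graph public

-- G - u : delete vertex u (and incident edges); the remaining vertices
-- are re-indexed by Fin n via punchIn u (an order-preserving bijection
-- Fin n ≅ Fin (suc n) ∖ {u}).
deleteVertex : ∀ {n} → Graph (suc n) → Fin (suc n) → Graph n
deleteVertex G u = record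
  { Adj    = λ x y → Adj G (punchIn u x) (punchIn u y)
  ; sym    = sym G
  ; irrefl = irrefl G
  }

InOpenNbhd : ∀ {n} → Graph n → Fin n → Fin n → Set
InOpenNbhd G v w = Adj G v w

InClosedNbhd : ∀ {n} → Graph n → Fin n → Fin n → Set
InClosedNbhd G v w = (w ≡ v) ⊎ Adj G v w

-- The footprint condition for an L-sequence, checked on the reversed
-- sequence: LSeqRev G (v_k ∷ ... ∷ v_1) says that for each i,
-- N[v_i] ∖ ⋃_{j<i} N(v_j) ≠ ∅.
LSeqRev : ∀ {n} → Graph n → List (Fin n) → Set
LSeqRev G []       = ⊤
LSeqRev G (v ∷ vs) =
  (∃ λ w → InClosedNbhd G v w × All (λ x → ¬ InOpenNbhd G x w) vs)
  × LSeqRev G vs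

IsLSequence : ∀ {n} → Graph n → List (Fin n) → Set
IsLSequence G vs = Unique vs × LSeqRev G vs

IsLGrundyNumber : ∀ {n} → Graph n → ℕ → Set
IsLGrundyNumber G k =
  (Σ (List _) λ vs → IsLSequence G vs × length vs ≡ k)
  × (∀ vs → IsLSequence G vs → length vs ≤ k)

{-# OPTIONS --safe #-}
-- Deleting u turns an L-sequence of G - u into one of G, which gives the upper bound.
-- Conversely, fix for each entry v of an L-sequence of G a footprint w ∈ N[v] lying in no
-- earlier open neighbourhood. Every entry other than u whose footprint is not u survives
-- in G - u. An entry v ≠ u with footprint u is adjacent to u, so at most one such
-- entry exists: all entries before it are non-adjacent to u, and so cannot have footprint u.
-- Hence at most two entries are lost.
module Submission where

open import Defs
open import Data.Nat using (ℕ; suc; _+_; _≤_; z≤n; s≤s)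
open import Data.Nat.Properties using (≤-trans; ≤-reflexive; +-suc; +-monoˡ-≤; +-monoʳ-≤)
open import Data.Fin using (Fin; punchIn; punchOut)
open import Data.Fin.Properties using (punchIn-injective; punchIn-punchOut; punchOut-cong; _≟_)
open import Data.List using (List; []; _∷_; length; map; filter)
open import Data.List.Properties using (length-map)
open import Data.List.Relation.Unary.All as All using (All; []; _∷_)
import Data.List.Relation.Unary.All.Properties as All
open import Data.List.Relation.Unary.Any using (here; there)
open import Data.List.Relation.Unary.AllPairs using ([]; _∷_)
open import Data.List.Relation.Unary.Unique.Propositional using (Unique)
import Data.List.Relation.Unary.Unique.Propositional.Properties as Unique
open import Data.List.Membership.Propositional using (_∈_)
open import Data.Product using (_×_; _,_; ∃; proj₁; proj₂)
import Data.Sum as Sum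
open import Data.Unit using (tt)
open import Data.Empty using (⊥-elim)
open import Function using (_∘_)
open import Relation.Nullary using (¬_; yes; no)
open import Relation.Binary.PropositionalEquality
  using (_≡_; _≢_; refl; cong; subst; subst₂; ≢-sym) renaming (sym to ≡-sym)

unique-all≡⇒length≤1 : ∀ {A : Set} {a : A} {xs : List A} →
                        Unique xs → All (_≡ a) xs → length xs ≤ 1
unique-all≡⇒length≤1 []                  _                  = z≤n
unique-all≡⇒length≤1 (_ ∷ [])            _                  = s≤s z≤n
unique-all≡⇒length≤1 ((x≢y ∷ _) ∷ _ ∷ _) (refl ∷ refl ∷ _) = ⊥-elim (x≢y refl)

module _ {n} (G : Graph (suc n)) (u : Fin (suc n)) where

  private
    H : Graph n
    H = deleteVertex G u

  LSeqRev-punchIn : ∀ ws → LSeqRev H ws → LSeqRev G (map (punchIn u) ws)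
  LSeqRev-punchIn []       _                           = tt
  LSeqRev-punchIn (v ∷ ws) ((w , v~w , free) , lseq) =
    (punchIn u w , Sum.map₁ (cong (punchIn u)) v~w , All.map⁺ free) , LSeqRev-punchIn ws lseq

  IsLSequence-punchIn : ∀ {ws} → IsLSequence H ws → IsLSequence G (map (punchIn u) ws)
  IsLSequence-punchIn (unique , lseq) =
    Unique.map⁺ (punchIn-injective u _ _) unique , LSeqRev-punchIn _ lseq

  occurrences : List (Fin (suc n)) → ℕ
  occurrences vs = length (filter (_≟ u) vs)

  unique⇒occurrences≤1 : ∀ {vs} → Unique vs → occurrences vs ≤ 1
  unique⇒occurrences≤1 {vs} unique =
    unique-all≡⇒length≤1 (Unique.filter⁺ (_≟ u) unique) (All.all-filter (_≟ u) vs)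

  footprint≢ : ∀ {v w} → v ≢ u → ¬ Adj G v u → InClosedNbhd G v w → u ≢ w
  footprint≢ v≢u v≁u v~w refl = Sum.[ v≢u ∘ ≡-sym , v≁u ] v~w

  record Restriction (vs : List (Fin (suc n))) (d : ℕ) : Set where
    field
      ws        : List (Fin n)
      isLSeq    : IsLSequence H ws
      drawnFrom : ∀ {x} → x ∈ ws → punchIn u x ∈ vs
      length≤   : length vs ≤ length ws + d

  open Restriction

  restriction-[] : ∀ {d} → Restriction [] d
  restriction-[] = record { ws = [] ; isLSeq = [] , tt ; drawnFrom = λ () ; length≤ = z≤n }

  dropHead : ∀ {v vs d} → Restriction vs d → Restriction (v ∷ vs) (suc d)
  dropHead {d = d} r = record
    { ws        = ws r
    ; isLSeq    = isLSeq r
    ; drawnFrom = there ∘ drawnFrom r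
    ; length≤   = ≤-trans (s≤s (length≤ r)) (≤-reflexive (≡-sym (+-suc (length (ws r)) d)))
    }

  keepHead : ∀ {v w vs d} (u≢v : u ≢ v) (u≢w : u ≢ w) →
             InClosedNbhd G v w → All (λ x → ¬ InOpenNbhd G x w) vs → All (v ≢_) vs →
             Restriction vs d → Restriction (v ∷ vs) d
  keepHead {v} {w} {vs} u≢v u≢w v~w free fresh r = record
    { ws        = punchOut u≢v ∷ ws r
    ; isLSeq    = All.tabulate fresh′ ∷ proj₁ (isLSeq r) , (punchOut u≢w , v~w′ , free′) , proj₂ (isLSeq r)
    ; drawnFrom = λ { (here refl) → here (punchIn-punchOut u≢v) ; (there x∈ws) → there (drawnFrom r x∈ws) }
    ; length≤   = s≤s (length≤ r)
    }
    where
    fresh′ : ∀ {x} → x ∈ ws r → punchOut u≢v ≢ x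
    fresh′ x∈ws refl = All.lookup fresh (subst (_∈ vs) (punchIn-punchOut u≢v) (drawnFrom r x∈ws)) refl

    v~w′ : InClosedNbhd H (punchOut u≢v) (punchOut u≢w)
    v~w′ = Sum.map (punchOut-cong u)
                   (subst₂ (Adj G) (≡-sym (punchIn-punchOut u≢v)) (≡-sym (punchIn-punchOut u≢w))) v~w

    free′ : All (λ x → ¬ InOpenNbhd H x (punchOut u≢w)) (ws r)
    free′ = All.tabulate λ x∈ws → All.lookup free (drawnFrom r x∈ws) ∘ subst (Adj G _) (punchIn-punchOut u≢w)

  restrictBlocked : ∀ vs → Unique vs → LSeqRev G vs → All (λ x → ¬ Adj G x u) vs →
                    Restriction vs (occurrences vs)
  restrictBlocked []       _                _                              _                  = restriction-[]
  restrictBlocked (v ∷ vs) (fresh ∷ unique) ((w , v~w , free) , lseq) (v≁u ∷ blocked) with v ≟ u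
  ... | yes _   = dropHead (restrictBlocked vs unique lseq blocked)
  ... | no v≢u  = keepHead (≢-sym v≢u) (footprint≢ v≢u v≁u v~w) v~w free fresh
                           (restrictBlocked vs unique lseq blocked)

  restrict : ∀ vs → Unique vs → LSeqRev G vs → Restriction vs (suc (occurrences vs))
  restrict []       _                _                              = restriction-[]
  restrict (v ∷ vs) (fresh ∷ unique) ((w , v~w , free) , lseq) with v ≟ u
  ... | yes _  = dropHead (restrict vs unique lseq)
  ... | no v≢u with u ≟ w
  ...   | no u≢w   = keepHead (≢-sym v≢u) u≢w v~w free fresh (restrict vs unique lseq)
  ...   | yes refl = dropHead (restrictBlocked vs unique lseq free)

  IsLSequence-restrict : ∀ {vs} → IsLSequence G vs →
                         ∃ λ ws → IsLSequence H ws × length vs ≤ length ws + 2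
  IsLSequence-restrict {vs} (unique , lseq) =
    ws r , isLSeq r , ≤-trans (length≤ r) (+-monoʳ-≤ (length (ws r)) (s≤s (unique⇒occurrences≤1 unique)))
    where r = restrict vs unique lseq

theorem4p3 : ∀ {n} (G : Graph (suc n)) (u : Fin (suc n)) (k k′ : ℕ) →
    IsLGrundyNumber G k → IsLGrundyNumber (deleteVertex G u) k′ →
    (k ≤ k′ + 2) × (k′ ≤ k)
theorem4p3 G u _ _ ((vs , isLSeqG , refl) , maximalG) ((ws , isLSeqH , refl) , maximalH) =
  lower , upper
  where
  lower : length vs ≤ length ws + 2
  lower with ws′ , isLSeq′ , vs≤ws′+2 ← IsLSequence-restrict G u isLSeqG =
    ≤-trans vs≤ws′+2 (+-monoˡ-≤ 2 (maximalH ws′ isLSeq′))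

  upper : length ws ≤ length vs
  upper = subst (_≤ length vs) (length-map (punchIn u) ws) (maximalG _ (IsLSequence-punchIn G u isLSeqH))
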